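{- Let $\chi$ be a real Dirichlet character (so $\chi(p)\in\{ -1,0,1\}$ for every prime $p$). Let $n$ be a positive integer and write $n=st$ where $s$ is a perfect square and $t$ is square-free. Then $$\lambda(n)\le\lambda(s)\lambda(t).$$
   Context: $\lambda=\chi\ast 1$, i.e. $\lambda(n)=\sum_{d\mid n}\chi(d)$. -}

module Defs where

open import Data.Nat as ℕ using (ℕ; suc; _+_)
open import Data.Nat.Divisibility using (_∣_; _∣?_)
open import Data.Nat.Coprimality using (Coprime)
open import Data.Integer as ℤ using (ℤ; +_; -[1+_])
open import Data.List using (List; filter; map; sum; upTo)
open import Data.Product using (∃; _×_)
open import Data.Sum using (_⊎_)
open import Relation.Binary.PropositionalEquality using (_≡_)
open import Relation.Nullary using (¬_)

record DirichletCharacter (q : ℕ) : Set where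
  field
    χ          : ℕ → ℤ
    one        : χ 1 ≡ + 1
    mult       : ∀ m n → χ (m ℕ.* n) ≡ χ m ℤ.* χ n
    periodic   : ∀ n → χ (n + q) ≡ χ n
    nonzero    : ∀ n → Coprime n q → ¬ (χ n ≡ + 0)
    zero-off   : ∀ n → ¬ Coprime n q → χ n ≡ + 0

IsReal : ∀ {q} → DirichletCharacter q → Set
IsReal X = ∀ n → (χ n ≡ + 0) ⊎ (χ n ≡ + 1) ⊎ (χ n ≡ -[1+ 0 ])
  where open DirichletCharacter X

divisors : ℕ → List ℕ
divisors n = filter (_∣? n) (map suc (upTo n))

lam : (ℕ → ℤ) → ℕ → ℤ
lam χ n = ℤsum (map χ (divisors n))
  where
  ℤsum : List ℤ → ℤ
  ℤsum = Data.List.foldr ℤ._+_ (+ 0)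

IsSquare : ℕ → Set
IsSquare s = ∃ λ m → s ≡ m ℕ.* m

SquareFree : ℕ → Set
SquareFree t = ∀ d → d ℕ.* d ∣ t → d ≡ 1

module Submission where

open import Defs
open import Data.Nat as ℕ using (ℕ; _*_; NonZero)
open import Data.Integer as ℤ using (ℤ)
open import Relation.Binary.PropositionalEquality using (_≡_)

import Algebra.Properties.CommutativeSemigroup as CommutativeSemigroup
open import Algebra.Bundles using (CommutativeMonoid)
open import Data.Integer using (+_; 0ℤ; 1ℤ; -1ℤ; +≤+)
import Data.Integer.Properties as ℤ
open import Data.Integer.Tactic.RingSolver using (solve-∀)
open import Data.List using (List; []; _∷_; _++_; map; foldr; upTo)
open import Data.List.Membership.Propositional using (_∈_)
open import Data.List.Membership.Propositional.Properties
  using (∈-map⁺; ∈-map⁻; ∈-filter⁺; ∈-filter⁻; ∈-upTo⁺; ∈-++⁺ˡ; ∈-++⁺ʳ; ∈-++⁻)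
open import Data.List.Membership.Propositional.Properties.WithK using (unique∧set⇒bag)
open import Data.List.Properties using (map-++; map-∘; map-cong)
open import Data.List.Relation.Binary.BagAndSetEquality using (∼bag⇒↭)
open import Data.List.Relation.Binary.Permutation.Propositional using (_↭_; ↭⇒↭ₛ)
import Data.List.Relation.Binary.Permutation.Propositional.Properties as ↭
open import Data.List.Relation.Binary.Permutation.Setoid.Properties using (foldr-commMonoid)
open import Data.List.Relation.Unary.All using (_∷_)
open import Data.List.Relation.Unary.Unique.Propositional using (Unique)
import Data.List.Relation.Unary.Unique.Propositional.Properties as Unique
open import Data.Nat using (zero; suc; _+_; _^_; _<_; z≤n; NonTrivial)
open import Data.Nat.Coprimality using (Coprime; coprime-divisor)
open import Data.Nat.Divisibility
open import Data.Nat.Induction using (<-wellFounded)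
open import Data.Nat.ListAction using (product)
import Data.Nat.Properties as ℕ
open import Data.Nat.Primality using (Prime; prime⇒irreducible; euclidsLemma; prime⇒nonZero; prime⇒nonTrivial)
open import Data.Nat.Primality.Factorisation using (factorise)
open import Data.Product using (∃-syntax; _×_; _,_; proj₂)
open import Data.Sum using (_⊎_; inj₁; inj₂; [_,_])
open import Function using (mk⇔)
open import Induction.WellFounded using (Acc; acc)
open import Relation.Binary.PropositionalEquality using (refl; sym; trans; cong; cong₂; subst; module ≡-Reasoning)
open import Relation.Nullary using (¬_; yes; no; contradiction)

-- For a prime p ∤ m the divisors of pᵏm are the products pʲd with j ≤ k and d ∣ m, so
-- λ(pᵏm) = G(k) λ(m) with G(k) = 1 + χ(p) + ⋯ + χ(p)ᵏ. When χ(p) ∈ {0, 1, −1} these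
-- geometric sums are non-negative (hence so is λ) and satisfy G(2c + e) ≤ G(2c) G(e):
-- for χ(p) = 1 this is 2c + e + 1 ≤ (2c + 1)(e + 1), and for χ(p) = −1 it is an equality,
-- since G has period 2 and G(0) = 1. Writing n = u²t and stripping the primes of u one at a
-- time therefore gives λ(u²t) ≤ λ(u²) λ(t).

module ℕ* = CommutativeSemigroup ℕ.*-commutativeSemigroup
module ℤ* = CommutativeSemigroup ℤ.*-commutativeSemigroup

-- lam χ n unfolds to sumℤ (map χ (divisors n)).
sumℤ : List ℤ → ℤ
sumℤ = foldr ℤ._+_ 0ℤ

sumℤ-↭ : ∀ {xs ys} → xs ↭ ys → sumℤ xs ≡ sumℤ ys
sumℤ-↭ xs↭ys = foldr-commMonoid ℤ+.setoid ℤ+.isCommutativeMonoid (↭⇒↭ₛ xs↭ys)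
  where module ℤ+ = CommutativeMonoid ℤ.+-0-commutativeMonoid

sumℤ-++ : ∀ xs ys → sumℤ (xs ++ ys) ≡ sumℤ xs ℤ.+ sumℤ ys
sumℤ-++ []       ys = sym (ℤ.+-identityˡ (sumℤ ys))
sumℤ-++ (x ∷ xs) ys = trans (cong (ℤ._+_ x) (sumℤ-++ xs ys)) (sym (ℤ.+-assoc x (sumℤ xs) (sumℤ ys)))

sumℤ-*ˡ : ∀ c xs → sumℤ (map (c ℤ.*_) xs) ≡ c ℤ.* sumℤ xs
sumℤ-*ˡ c []       = sym (ℤ.*-zeroʳ c)
sumℤ-*ˡ c (x ∷ xs) = trans (cong (ℤ._+_ (c ℤ.* x)) (sumℤ-*ˡ c xs)) (sym (ℤ.*-distribˡ-+ c x (sumℤ xs)))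

∤⇒coprime : ∀ {p d} → Prime p → ¬ p ∣ d → Coprime d p
∤⇒coprime p-prime p∤d (c∣d , c∣p) with prime⇒irreducible p-prime c∣p
... | inj₁ c≡1 = c≡1
... | inj₂ refl = contradiction c∣d p∤d

coprime-divisor-^ : ∀ {d p m} → Coprime d p → ∀ k → d ∣ p ^ k * m → d ∣ m
coprime-divisor-^ {d} {p} {m} d⊥p zero    d∣ = subst (d ∣_) (ℕ.*-identityˡ m) d∣
coprime-divisor-^ {d} {p} {m} d⊥p (suc k) d∣ =
  coprime-divisor-^ d⊥p k (coprime-divisor d⊥p (subst (d ∣_) (ℕ.*-assoc p (p ^ k) m) d∣))

∤-* : ∀ {p m n} → Prime p → ¬ p ∣ m → ¬ p ∣ n → ¬ p ∣ m * n
∤-* p-prime p∤m p∤n p∣mn = [ p∤m , p∤n ] (euclidsLemma _ _ p-prime p∣mn)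

∃-prime-divisor : ∀ n → .{{NonTrivial n}} → ∃[ p ] Prime p × p ∣ n
∃-prime-divisor n@(suc (suc _)) with factorise n
... | record { factors = [] ; isFactorisation = () }
... | record { factors = p ∷ ps ; isFactorisation = n≡p*ps ; factorsPrime = p-prime ∷ _ } =
  p , p-prime , subst (p ∣_) (sym n≡p*ps) (m∣m*n (product ps))

split-prime-power : ∀ {p} → Prime p → ∀ n → .{{NonZero n}} → ∃[ k ] ∃[ m ] n ≡ p ^ k * m × ¬ p ∣ m
split-prime-power {p} p-prime n = split n (<-wellFounded n)
  where
  instance
    p>1 : NonTrivial p
    p>1 = prime⇒nonTrivial p-prime

  split : ∀ n → Acc _<_ n → .{{NonZero n}} → ∃[ k ] ∃[ m ] n ≡ p ^ k * m × ¬ p ∣ m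
  split n (acc rec) with p ∣? n
  ... | no p∤n = 0 , n , sym (ℕ.*-identityˡ n) , p∤n
  ... | yes p∣n with split (quotient p∣n) (rec (quotient-< p∣n)) {{quotient≢0 p∣n}}
  ...   | k , m , n/p≡pᵏm , p∤m = suc k , m , n≡pᵏ⁺¹m , p∤m
    where
    n≡pᵏ⁺¹m : n ≡ p * p ^ k * m
    n≡pᵏ⁺¹m = trans (m∣n⇒n≡m*quotient p∣n) (trans (cong (p *_) n/p≡pᵏm) (sym (ℕ.*-assoc p (p ^ k) m)))

primePower-induction : ∀ {ℓ} (P : ℕ → Set ℓ) → P 1 →
                       (∀ {p m} k → Prime p → ¬ p ∣ m → .{{NonZero m}} → P m → P (p ^ suc k * m)) →
                       ∀ n → .{{NonZero n}} → P n
primePower-induction P P1 step n = induct n (<-wellFounded n)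
  where
  induct : ∀ n → Acc _<_ n → .{{NonZero n}} → P n
  induct 1 _ = P1
  induct n@(suc (suc _)) (acc rec) with ∃-prime-divisor n
  ... | p , p-prime , p∣n with split-prime-power p-prime n
  ...   | zero  , m , n≡1*m , p∤m = contradiction (subst (p ∣_) (trans n≡1*m (ℕ.*-identityˡ m)) p∣n) p∤m
  ...   | suc k , m , n≡pᵏ⁺¹m , p∤m = subst P (sym n≡pᵏ⁺¹m) (step k p-prime p∤m (induct m (rec m<n)))
    where
    instance
      m≢0 : NonZero m
      m≢0 = ℕ.m*n≢0⇒n≢0 (p ^ suc k) {{subst NonZero n≡pᵏ⁺¹m _}}
    m<n : m < n
    m<n = subst (m <_) (trans (ℕ.*-comm m (p ^ suc k)) (sym n≡pᵏ⁺¹m))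
            (ℕ.m<m*n m (p ^ suc k) (ℕ.^-monoʳ-< p (ℕ.nonTrivial⇒n>1 p {{prime⇒nonTrivial p-prime}}) {0} {suc k} ℕ.z<s))

∈-divisors⁻ : ∀ {n d} → d ∈ divisors n → d ∣ n
∈-divisors⁻ {n} d∈ = proj₂ (∈-filter⁻ (_∣? n) {xs = map suc (upTo n)} d∈)

∈-divisors⁺ : ∀ {n d} .{{_ : NonZero n}} → d ∣ n → d ∈ divisors n
∈-divisors⁺ {n} {zero}  0∣n = contradiction (0∣⇒≡0 0∣n) (ℕ.≢-nonZero⁻¹ n)
∈-divisors⁺ {n} {suc d} d∣n = ∈-filter⁺ (_∣? n) (∈-map⁺ suc (∈-upTo⁺ (∣⇒≤ d∣n))) d∣n

divisors-unique : ∀ n → Unique (divisors n)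
divisors-unique n = Unique.filter⁺ (_∣? n) (Unique.map⁺ ℕ.suc-injective (Unique.upTo⁺ n))

module _ {p m : ℕ} (p-prime : Prime p) (p∤m : ¬ p ∣ m) .{{_ : NonZero m}} (k : ℕ) where

  private
    N = p ^ k * m
    instance
      p≢0 : NonZero p
      p≢0 = prime⇒nonZero p-prime
      N≢0 : NonZero N
      N≢0 = ℕ.m*n≢0 (p ^ k) m {{ℕ.m^n≢0 p k}}
      pN≢0 : NonZero (p * N)
      pN≢0 = ℕ.m*n≢0 p N

  -- A divisor of p·pᵏm either is p times a divisor of pᵏm or, being coprime to p, divides m.
  divisors-p*-↭ : divisors (p * N) ↭ divisors m ++ map (p *_) (divisors N)
  divisors-p*-↭ = ∼bag⇒↭ (unique∧set⇒bag (divisors-unique (p * N)) unique (mk⇔ to from))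
    where
    disjoint : ∀ {d} → ¬ (d ∈ divisors m × d ∈ map (p *_) (divisors N))
    disjoint (d∈ , pe∈) with ∈-map⁻ (p *_) pe∈
    ... | e , _ , refl = p∤m (∣-trans (m∣m*n e) (∈-divisors⁻ d∈))

    unique : Unique (divisors m ++ map (p *_) (divisors N))
    unique = Unique.++⁺ (divisors-unique m) (Unique.map⁺ (ℕ.*-cancelˡ-≡ _ _ p) (divisors-unique N)) disjoint

    to : ∀ {d} → d ∈ divisors (p * N) → d ∈ divisors m ++ map (p *_) (divisors N)
    to {d} d∈ with p ∣? d
    ... | yes (divides e refl) = ∈-++⁺ʳ (divisors m) (subst (_∈ map (p *_) (divisors N)) (ℕ.*-comm p e)
            (∈-map⁺ (p *_) (∈-divisors⁺ (*-cancelˡ-∣ p (subst (_∣ p * N) (ℕ.*-comm e p) (∈-divisors⁻ d∈))))))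
    ... | no p∤d = ∈-++⁺ˡ (∈-divisors⁺ (coprime-divisor-^ (∤⇒coprime p-prime p∤d) (suc k)
            (subst (d ∣_) (sym (ℕ.*-assoc p (p ^ k) m)) (∈-divisors⁻ d∈))))

    from : ∀ {d} → d ∈ divisors m ++ map (p *_) (divisors N) → d ∈ divisors (p * N)
    from d∈ with ∈-++⁻ (divisors m) d∈
    ... | inj₁ d∈m = ∈-divisors⁺ (∣n⇒∣m*n p (∣n⇒∣m*n (p ^ k) (∈-divisors⁻ d∈m)))
    ... | inj₂ pe∈ with ∈-map⁻ (p *_) pe∈
    ...   | e , e∈ , refl = ∈-divisors⁺ (*-monoʳ-∣ p (∈-divisors⁻ e∈))

*-nonNeg : ∀ {i j} → 0ℤ ℤ.≤ i → 0ℤ ℤ.≤ j → 0ℤ ℤ.≤ i ℤ.* j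
*-nonNeg {+ m} {+ n} _ _ = subst (0ℤ ℤ.≤_) (ℤ.pos-* m n) (+≤+ z≤n)

geometricSum : ℤ → ℕ → ℤ
geometricSum x zero    = 1ℤ
geometricSum x (suc k) = 1ℤ ℤ.+ x ℤ.* geometricSum x k

RealValue : ℤ → Set
RealValue v = v ≡ 0ℤ ⊎ v ≡ 1ℤ ⊎ v ≡ -1ℤ

geometricSum-0 : ∀ k → geometricSum 0ℤ k ≡ 1ℤ
geometricSum-0 zero    = refl
geometricSum-0 (suc k) = refl

geometricSum-1 : ∀ k → geometricSum 1ℤ k ≡ + suc k
geometricSum-1 zero    = refl
geometricSum-1 (suc k) = cong (ℤ._+_ 1ℤ) (trans (ℤ.*-identityˡ (geometricSum 1ℤ k)) (geometricSum-1 k))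

geometricSum-−1-2+ : ∀ k → geometricSum -1ℤ (2 + k) ≡ geometricSum -1ℤ k
geometricSum-−1-2+ k = cancel (geometricSum -1ℤ k)
  where
  cancel : ∀ g → 1ℤ ℤ.+ -1ℤ ℤ.* (1ℤ ℤ.+ -1ℤ ℤ.* g) ≡ g
  cancel = solve-∀

geometricSum-−1-even+ : ∀ c e → geometricSum -1ℤ (c + c + e) ≡ geometricSum -1ℤ e
geometricSum-−1-even+ zero    e = refl
geometricSum-−1-even+ (suc c) e = begin
  geometricSum -1ℤ (suc (c + suc c + e)) ≡⟨ cong (λ j → geometricSum -1ℤ (suc j + e)) (ℕ.+-suc c c) ⟩
  geometricSum -1ℤ (2 + (c + c + e))     ≡⟨ geometricSum-−1-2+ (c + c + e) ⟩
  geometricSum -1ℤ (c + c + e)           ≡⟨ geometricSum-−1-even+ c e ⟩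
  geometricSum -1ℤ e                     ∎
  where open ≡-Reasoning

geometricSum-nonNeg : ∀ {v} → RealValue v → ∀ k → 0ℤ ℤ.≤ geometricSum v k
geometricSum-nonNeg (inj₁ refl)        k = subst (0ℤ ℤ.≤_) (sym (geometricSum-0 k)) (+≤+ z≤n)
geometricSum-nonNeg (inj₂ (inj₁ refl)) k = subst (0ℤ ℤ.≤_) (sym (geometricSum-1 k)) (+≤+ z≤n)
geometricSum-nonNeg (inj₂ (inj₂ refl)) k = alternating k
  where
  alternating : ∀ k → 0ℤ ℤ.≤ geometricSum -1ℤ k
  alternating zero          = +≤+ z≤n
  alternating (suc zero)    = +≤+ z≤n
  alternating (suc (suc k)) = subst (0ℤ ℤ.≤_) (sym (geometricSum-−1-2+ k)) (alternating k)

1+m+n≤[1+m]*[1+n] : ∀ m n → suc (m + n) ℕ.≤ suc m * suc n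
1+m+n≤[1+m]*[1+n] m n = begin
  suc (m + n)       ≡⟨ cong suc (ℕ.+-comm m n) ⟩
  suc n + m         ≤⟨ ℕ.+-monoʳ-≤ (suc n) (ℕ.m≤m*n m (suc n)) ⟩
  suc n + m * suc n ∎
  where open ℕ.≤-Reasoning

geometricSum-submult : ∀ {v} → RealValue v → ∀ c e →
                       geometricSum v (c + c + e) ℤ.≤ geometricSum v (c + c) ℤ.* geometricSum v e
geometricSum-submult (inj₁ refl) c e
  rewrite geometricSum-0 (c + c + e) | geometricSum-0 (c + c) | geometricSum-0 e = ℤ.≤-refl
geometricSum-submult (inj₂ (inj₁ refl)) c e
  rewrite geometricSum-1 (c + c + e) | geometricSum-1 (c + c) | geometricSum-1 e = +≤+ (1+m+n≤[1+m]*[1+n] (c + c) e)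
geometricSum-submult (inj₂ (inj₂ refl)) c e = ℤ.≤-reflexive (begin
  geometricSum -1ℤ (c + c + e)                       ≡⟨ geometricSum-−1-even+ c e ⟩
  geometricSum -1ℤ e                                 ≡⟨ ℤ.*-identityˡ (geometricSum -1ℤ e) ⟨
  1ℤ ℤ.* geometricSum -1ℤ e                          ≡⟨ cong (ℤ._* geometricSum -1ℤ e) even≡1 ⟨
  geometricSum -1ℤ (c + c) ℤ.* geometricSum -1ℤ e    ∎)
  where
  open ≡-Reasoning
  even≡1 : geometricSum -1ℤ (c + c) ≡ 1ℤ
  even≡1 = trans (cong (geometricSum -1ℤ) (sym (ℕ.+-identityʳ (c + c)))) (geometricSum-−1-even+ c 0)

module _ (χ : ℕ → ℤ) (χ-mult : ∀ m n → χ (m * n) ≡ χ m ℤ.* χ n)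
         {p m : ℕ} (p-prime : Prime p) (p∤m : ¬ p ∣ m) .{{_ : NonZero m}} where

  lam-p* : ∀ k → lam χ (p * (p ^ k * m)) ≡ lam χ m ℤ.+ χ p ℤ.* lam χ (p ^ k * m)
  lam-p* k = begin
    sumℤ (map χ (divisors (p * N)))
      ≡⟨ sumℤ-↭ (↭.map⁺ χ (divisors-p*-↭ p-prime p∤m k)) ⟩
    sumℤ (map χ (divisors m ++ map (p *_) (divisors N)))
      ≡⟨ cong sumℤ (map-++ χ (divisors m) (map (p *_) (divisors N))) ⟩
    sumℤ (map χ (divisors m) ++ map χ (map (p *_) (divisors N)))
      ≡⟨ sumℤ-++ (map χ (divisors m)) (map χ (map (p *_) (divisors N))) ⟩
    lam χ m ℤ.+ sumℤ (map χ (map (p *_) (divisors N)))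
      ≡⟨ cong (λ xs → lam χ m ℤ.+ sumℤ xs) χ∘p*≡χp*∘χ ⟩
    lam χ m ℤ.+ sumℤ (map (χ p ℤ.*_) (map χ (divisors N)))
      ≡⟨ cong (ℤ._+_ (lam χ m)) (sumℤ-*ˡ (χ p) (map χ (divisors N))) ⟩
    lam χ m ℤ.+ χ p ℤ.* lam χ N ∎
    where
    open ≡-Reasoning
    N = p ^ k * m
    χ∘p*≡χp*∘χ : map χ (map (p *_) (divisors N)) ≡ map (χ p ℤ.*_) (map χ (divisors N))
    χ∘p*≡χp*∘χ = trans (sym (map-∘ (divisors N))) (trans (map-cong (χ-mult p) (divisors N)) (map-∘ (divisors N)))

  lam-^* : ∀ k → lam χ (p ^ k * m) ≡ geometricSum (χ p) k ℤ.* lam χ m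
  lam-^* zero    = trans (cong (lam χ) (ℕ.*-identityˡ m)) (sym (ℤ.*-identityˡ (lam χ m)))
  lam-^* (suc k) = begin
    lam χ (p * p ^ k * m)                                       ≡⟨ cong (lam χ) (ℕ.*-assoc p (p ^ k) m) ⟩
    lam χ (p * (p ^ k * m))                                     ≡⟨ lam-p* k ⟩
    lam χ m ℤ.+ χ p ℤ.* lam χ (p ^ k * m)                       ≡⟨ cong (λ x → lam χ m ℤ.+ χ p ℤ.* x) (lam-^* k) ⟩
    lam χ m ℤ.+ χ p ℤ.* (geometricSum (χ p) k ℤ.* lam χ m)      ≡⟨ horner (lam χ m) (χ p) (geometricSum (χ p) k) ⟩
    (1ℤ ℤ.+ χ p ℤ.* geometricSum (χ p) k) ℤ.* lam χ m           ∎
    where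
    open ≡-Reasoning
    horner : ∀ a x g → a ℤ.+ x ℤ.* (g ℤ.* a) ≡ (1ℤ ℤ.+ x ℤ.* g) ℤ.* a
    horner = solve-∀

square-^* : ∀ p c m → (p ^ c * m) * (p ^ c * m) ≡ p ^ (c + c) * (m * m)
square-^* p c m = trans (ℕ*.interchange (p ^ c) m (p ^ c) m) (cong (_* (m * m)) (sym (ℕ.^-distribˡ-+-* p c c)))

square-^*-^* : ∀ p c e m t → (p ^ c * m) * (p ^ c * m) * (p ^ e * t) ≡ p ^ (c + c + e) * (m * m * t)
square-^*-^* p c e m t = begin
  (p ^ c * m) * (p ^ c * m) * (p ^ e * t)   ≡⟨ cong (_* (p ^ e * t)) (square-^* p c m) ⟩
  p ^ (c + c) * (m * m) * (p ^ e * t)       ≡⟨ ℕ*.interchange (p ^ (c + c)) (m * m) (p ^ e) t ⟩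
  p ^ (c + c) * p ^ e * (m * m * t)         ≡⟨ cong (_* (m * m * t)) (ℕ.^-distribˡ-+-* p (c + c) e) ⟨
  p ^ (c + c + e) * (m * m * t)             ∎
  where open ≡-Reasoning

module _ (χ : ℕ → ℤ) (χ-mult : ∀ m n → χ (m * n) ≡ χ m ℤ.* χ n) (χ-one : χ 1 ≡ 1ℤ)
         (χ-real : ∀ n → RealValue (χ n)) where

  lam-1 : lam χ 1 ≡ 1ℤ
  lam-1 = trans (ℤ.+-identityʳ (χ 1)) χ-one

  lam-nonNeg : ∀ n → .{{NonZero n}} → 0ℤ ℤ.≤ lam χ n
  lam-nonNeg = primePower-induction (λ n → 0ℤ ℤ.≤ lam χ n) (subst (0ℤ ℤ.≤_) (sym lam-1) (+≤+ z≤n))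
    λ {p} k p-prime p∤m 0≤λm → subst (0ℤ ℤ.≤_) (sym (lam-^* χ χ-mult p-prime p∤m (suc k)))
                                  (*-nonNeg (geometricSum-nonNeg (χ-real p) (suc k)) 0≤λm)

  lam-square-submult : ∀ u → .{{NonZero u}} → ∀ t → .{{NonZero t}} →
                       lam χ (u * u * t) ℤ.≤ lam χ (u * u) ℤ.* lam χ t
  lam-square-submult = primePower-induction SubmultAt base step
    where
    SubmultAt : ℕ → Set
    SubmultAt u = ∀ t → .{{NonZero t}} → lam χ (u * u * t) ℤ.≤ lam χ (u * u) ℤ.* lam χ t

    base : SubmultAt 1
    base t = ℤ.≤-reflexive (begin
      lam χ (1 * t)         ≡⟨ cong (lam χ) (ℕ.*-identityˡ t) ⟩
      lam χ t               ≡⟨ ℤ.*-identityˡ (lam χ t) ⟨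
      1ℤ ℤ.* lam χ t        ≡⟨ cong (ℤ._* lam χ t) lam-1 ⟨
      lam χ 1 ℤ.* lam χ t   ∎)
      where open ≡-Reasoning

    step : ∀ {p m} k → Prime p → ¬ p ∣ m → .{{NonZero m}} → SubmultAt m → SubmultAt (p ^ suc k * m)
    step {p} {m} k p-prime p∤m IH t with split-prime-power p-prime t
    ... | e , t₁ , refl , p∤t₁ = begin
      lam χ (u * u * (p ^ e * t₁))
        ≡⟨ cong (lam χ) (square-^*-^* p c e m t₁) ⟩
      lam χ (p ^ (c + c + e) * (m * m * t₁))
        ≡⟨ lam-^* χ χ-mult p-prime p∤m²t₁ (c + c + e) ⟩
      G (c + c + e) ℤ.* lam χ (m * m * t₁)
        ≤⟨ ℤ.*-monoʳ-≤-nonNeg (lam χ (m * m * t₁)) {{ℤ.nonNegative (lam-nonNeg (m * m * t₁))}}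
             (geometricSum-submult (χ-real p) c e) ⟩
      (G (c + c) ℤ.* G e) ℤ.* lam χ (m * m * t₁)
        ≤⟨ ℤ.*-monoˡ-≤-nonNeg (G (c + c) ℤ.* G e) {{ℤ.nonNegative (*-nonNeg (G-nonNeg (c + c)) (G-nonNeg e))}}
             (IH t₁) ⟩
      (G (c + c) ℤ.* G e) ℤ.* (lam χ (m * m) ℤ.* lam χ t₁)
        ≡⟨ ℤ*.interchange (G (c + c)) (G e) (lam χ (m * m)) (lam χ t₁) ⟩
      (G (c + c) ℤ.* lam χ (m * m)) ℤ.* (G e ℤ.* lam χ t₁)
        ≡⟨ cong₂ ℤ._*_ (lam-^* χ χ-mult p-prime p∤m² (c + c)) (lam-^* χ χ-mult p-prime p∤t₁ e) ⟨
      lam χ (p ^ (c + c) * (m * m)) ℤ.* lam χ (p ^ e * t₁)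
        ≡⟨ cong (λ x → lam χ x ℤ.* lam χ (p ^ e * t₁)) (square-^* p c m) ⟨
      lam χ (u * u) ℤ.* lam χ (p ^ e * t₁)
        ∎
      where
      open ℤ.≤-Reasoning
      c = suc k
      u = p ^ c * m
      G = geometricSum (χ p)
      G-nonNeg : ∀ j → 0ℤ ℤ.≤ G j
      G-nonNeg = geometricSum-nonNeg (χ-real p)
      instance
        t₁≢0 : NonZero t₁
        t₁≢0 = ℕ.m*n≢0⇒n≢0 (p ^ e)
        m²≢0 : NonZero (m * m)
        m²≢0 = ℕ.m*n≢0 m m
        m²t₁≢0 : NonZero (m * m * t₁)
        m²t₁≢0 = ℕ.m*n≢0 (m * m) t₁
      p∤m² : ¬ p ∣ m * m
      p∤m² = ∤-* p-prime p∤m p∤m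
      p∤m²t₁ : ¬ p ∣ m * m * t₁
      p∤m²t₁ = ∤-* p-prime p∤m² p∤t₁

lemma5 : ∀ {q} .{{_ : NonZero q}} (X : DirichletCharacter q) → IsReal X →
           ∀ (n s t : ℕ) → .{{NonZero n}} → n ≡ s * t → IsSquare s → SquareFree t →
           let open DirichletCharacter X in
           lam χ n ℤ.≤ lam χ s ℤ.* lam χ t
lemma5 X real _ _ t refl (m , refl) _ = lam-square-submult χ mult one real m t
  where
  open DirichletCharacter X
  instance
    m≢0 : NonZero m
    m≢0 = ℕ.m*n≢0⇒m≢0 m {{ℕ.m*n≢0⇒m≢0 (m * m)}}
    t≢0 : NonZero t
    t≢0 = ℕ.m*n≢0⇒n≢0 (m * m)
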